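{- Let $G$ be a complete $k$-partite graph in which exactly $m$ of the partite sets have cardinality $1$, where $m<k$. Then $\rho_T(G)=k-m$.
   Context: Graphs are finite and simple. A complete $k$-partite graph is one whose vertex set is partitioned into $k$ nonempty independent sets (partite sets) such that two vertices are adjacent iff they lie in different partite sets. For $u,v\in(\mathbb{R}\cup\{\infty\})^r$, $u\odot v=\min_i(u_i+v_i)$. $\rho_T(G)$ is the minimum $r$ such that there is $f:V(G)\to(\mathbb{R}\cup\{\infty\})^r$ and a threshold $t>0$ with, for all distinct $x,y$, $xy\in E(G)$ iff $f(x)\odot f(y)\ge t$.
   Formalization: The vectors $f(x)$ have coordinates in ℚ ∪ {∞} and the threshold $t$ is rational, instead of coordinates in $\mathbb{R}\cup\{\infty\}$ and a real threshold. -}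

module Defs where

open import Data.Nat using (ℕ; zero; suc)
open import Data.Fin using (Fin; _≟_)
open import Data.List using (List; length; filter)
open import Data.List.Base using (allFin)
open import Data.Vec using (Vec; zipWith; foldr′)
open import Data.Rational using (ℚ; _+_; _⊓_; _≤_; _<_; 0ℚ)
open import Data.Product using (Σ; _×_; ∃)
open import Relation.Binary.PropositionalEquality using (_≡_; _≢_)
open import Relation.Nullary using (¬_)
open import Level using (0ℓ; suc)

record Graph (n : ℕ) : Set₁ where
  field
    Adj   : Fin n → Fin n → Set
    sym   : ∀ {x y} → Adj x y → Adj y x
    irrefl : ∀ {x} → ¬ Adj x x
open Graph public

-- p : Fin n → Fin k is a partition of V(G) into k nonempty partite sets
-- (p x = index of the partite set of x) witnessing that G is complete k-partite.
IsCompletePartition : ∀ {n} → Graph n → (k : ℕ) → (Fin n → Fin k) → Set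
IsCompletePartition {n} G k p =
  (∀ (i : Fin k) → ∃ λ x → p x ≡ i) ×
  (∀ (x y : Fin n) → x ≢ y → (Adj G x y → p x ≢ p y) × (p x ≢ p y → Adj G x y))

partSize : ∀ {n k} → (Fin n → Fin k) → Fin k → ℕ
partSize {n} p i = length (filter (λ x → p x ≟ i) (allFin n))

numSingletonParts : ∀ {n k} → (Fin n → Fin k) → ℕ
numSingletonParts {n} {k} p =
  length (filter (λ i → partSize p i Data.Nat.≟ 1) (allFin k))

-- Extended reals ℝ ∪ {∞} (rationals used instead of reals)
data Ext : Set where
  fin : ℚ → Ext
  ∞   : Ext

_+ᵉ_ : Ext → Ext → Ext
fin a +ᵉ fin b = fin (a + b)
fin a +ᵉ ∞ = ∞
∞ +ᵉ _ = ∞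

minᵉ : Ext → Ext → Ext
minᵉ (fin a) (fin b) = fin (a ⊓ b)
minᵉ (fin a) ∞ = fin a
minᵉ ∞ y = y

_≤ᵉ_ : ℚ → Ext → Set
t ≤ᵉ fin a = t ≤ a
t ≤ᵉ ∞ = Data.Unit.⊤
  where import Data.Unit

-- u ⊙ v = min_i (u_i + v_i)   (min of the empty family is ∞)
_⊙_ : ∀ {r} → Vec Ext r → Vec Ext r → Ext
u ⊙ v = foldr′ minᵉ ∞ (zipWith _+ᵉ_ u v)

ThresholdRep : ∀ {n} → Graph n → ℕ → Set
ThresholdRep {n} G r =
  Σ (Fin n → Vec Ext r) λ f → Σ ℚ λ t → (0ℚ < t) ×
    (∀ (x y : Fin n) → x ≢ y → (Adj G x y → t ≤ᵉ (f x ⊙ f y)) × (t ≤ᵉ (f x ⊙ f y) → Adj G x y))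

ρT≡ : ∀ {n} → Graph n → ℕ → Set
ρT≡ G r = ThresholdRep G r × (∀ s → ThresholdRep G s → r Data.Nat.≤ s)

{-# OPTIONS --safe #-}
-- Upper bound: use one coordinate per part of size at least 2, giving a vertex the value 0 in the
-- coordinate of its own part and ∞ elsewhere.  With threshold 1, f x ⊙ f y is then 0 + 0 when x and y
-- share such a part and ∞ otherwise.
-- Lower bound: choose distinct a_j, b_j in every part j of size at least 2.  Since a_j b_j is a non-edge,
-- some coordinate i_j has f(a_j)_i + f(b_j)_i < t.  If i_j = i_j' for j ≠ j', the edges a_j a_j' and
-- b_j b_j' give f(a_j)_i + f(a_j')_i ≥ t and f(b_j)_i + f(b_j')_i ≥ t; adding these and regrouping
-- contradicts the two strict inequalities.  So j ↦ i_j is injective.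
module Submission where

open import Defs
open import Relation.Binary.PropositionalEquality using (_≡_)
open import Data.Nat using (ℕ; _<_; _∸_)
open import Data.Fin using (Fin)

open import Algebra.Bundles using (CommutativeMonoid)
import Algebra.Properties.CommutativeSemigroup as CommutativeSemigroupProperties
open import Data.Empty using (⊥-elim)
open import Data.Fin using (zero; suc; _≟_)
open import Data.Fin.Properties using (¬∀⟶∃¬; injective⇒≤)
open import Data.List using (List; []; _∷_; length; filter; allFin)
import Data.List as List
open import Data.List.Membership.Propositional using (_∈_)
open import Data.List.Membership.Propositional.Properties using (∈-filter⁺; ∈-filter⁻; ∈-allFin; ∈-lookup)
open import Data.List.Properties using (length-tabulate)
import Data.List.Relation.Unary.All as All
open import Data.List.Relation.Unary.AllPairs using (_∷_)
open import Data.List.Relation.Unary.Any using (here; there; index)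
open import Data.List.Relation.Unary.Any.Properties using (lookup-index)
open import Data.List.Relation.Unary.Unique.Propositional using (Unique)
open import Data.List.Relation.Unary.Unique.Propositional.Properties using (filter⁺; allFin⁺)
import Data.Nat as ℕ
import Data.Nat.Properties as ℕₚ
open import Data.Product using (_×_; _,_; proj₁; proj₂; ∃; ∃₂)
import Data.Rational as ℚ
import Data.Rational.Properties as ℚₚ
open import Data.Unit using (tt)
open import Data.Vec using (Vec; []; _∷_; lookup; tabulate)
open import Data.Vec.Properties using (lookup∘tabulate)
open import Function using (_∘_)
open import Function.Definitions using (Injective)
open import Relation.Binary.PropositionalEquality using (_≢_; refl; cong; cong₂; subst; module ≡-Reasoning)
import Relation.Binary.PropositionalEquality as ≡
open import Relation.Nullary using (¬_; Dec; yes; no; ¬?)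
open import Relation.Nullary.Decidable using (decidable-stable)
open import Relation.Unary using (Decidable)

private
  variable
    A : Set
    n k r : ℕ

≤ᵉ-minᵉ⁻ : ∀ {t} x y → t ≤ᵉ minᵉ x y → t ≤ᵉ x × t ≤ᵉ y
≤ᵉ-minᵉ⁻ (fin a) (fin b) t≤a⊓b = ℚₚ.≤-trans t≤a⊓b (ℚₚ.p⊓q≤p a b) , ℚₚ.≤-trans t≤a⊓b (ℚₚ.p⊓q≤q a b)
≤ᵉ-minᵉ⁻ (fin a) ∞       t≤a   = t≤a , tt
≤ᵉ-minᵉ⁻ ∞       y       t≤y   = tt , t≤y

≤ᵉ-minᵉ⁺ : ∀ {t} x y → t ≤ᵉ x → t ≤ᵉ y → t ≤ᵉ minᵉ x y
≤ᵉ-minᵉ⁺ (fin a) (fin b) t≤a t≤b = ℚₚ.⊓-glb t≤a t≤b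
≤ᵉ-minᵉ⁺ (fin a) ∞       t≤a _   = t≤a
≤ᵉ-minᵉ⁺ ∞       y       _   t≤y = t≤y

_≤ᵉ?_ : ∀ t e → Dec (t ≤ᵉ e)
t ≤ᵉ? fin a = t ℚ.≤? a
t ≤ᵉ? ∞     = yes tt

≤ᵉ-⊙⁻ : ∀ {t} (u v : Vec Ext r) → t ≤ᵉ (u ⊙ v) → ∀ i → t ≤ᵉ (lookup u i +ᵉ lookup v i)
≤ᵉ-⊙⁻ (x ∷ u) (y ∷ v) t≤ zero    = proj₁ (≤ᵉ-minᵉ⁻ (x +ᵉ y) (u ⊙ v) t≤)
≤ᵉ-⊙⁻ (x ∷ u) (y ∷ v) t≤ (suc i) = ≤ᵉ-⊙⁻ u v (proj₂ (≤ᵉ-minᵉ⁻ (x +ᵉ y) (u ⊙ v) t≤)) i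

≤ᵉ-⊙⁺ : ∀ {t} (u v : Vec Ext r) → (∀ i → t ≤ᵉ (lookup u i +ᵉ lookup v i)) → t ≤ᵉ (u ⊙ v)
≤ᵉ-⊙⁺ []      []      _  = tt
≤ᵉ-⊙⁺ (x ∷ u) (y ∷ v) t≤ = ≤ᵉ-minᵉ⁺ (x +ᵉ y) (u ⊙ v) (t≤ zero) (≤ᵉ-⊙⁺ u v (t≤ ∘ suc))

≰ᵉ-⊙⁻ : ∀ {t} (u v : Vec Ext r) → ¬ (t ≤ᵉ (u ⊙ v)) → ∃ λ i → ¬ (t ≤ᵉ (lookup u i +ᵉ lookup v i))
≰ᵉ-⊙⁻ {r} {t} u v t≰ = ¬∀⟶∃¬ r _ (λ i → t ≤ᵉ? (lookup u i +ᵉ lookup v i)) (t≰ ∘ ≤ᵉ-⊙⁺ u v)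

+-interchange-threshold : ∀ {t} (a b c d : ℚ.ℚ) → a ℚ.+ b ℚ.< t → c ℚ.+ d ℚ.< t →
                          t ℚ.≤ a ℚ.+ c → ¬ (t ℚ.≤ b ℚ.+ d)
+-interchange-threshold {t} a b c d a+b<t c+d<t t≤a+c t≤b+d = ℚₚ.<-irrefl refl (begin-strict
  t + t             ≤⟨ ℚₚ.+-mono-≤ t≤a+c t≤b+d ⟩
  (a + c) + (b + d) ≡⟨ interchange a c b d ⟩
  (a + b) + (c + d) <⟨ ℚₚ.+-mono-< a+b<t c+d<t ⟩
  t + t             ∎)
  where
  open ℚ using (_+_)
  open ℚₚ.≤-Reasoning
  open CommutativeSemigroupProperties (CommutativeMonoid.commutativeSemigroup ℚₚ.+-0-commutativeMonoid)

+ᵉ-interchange-threshold : ∀ {t} x y x′ y′ → ¬ (t ≤ᵉ (x +ᵉ y)) → ¬ (t ≤ᵉ (x′ +ᵉ y′)) →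
                           t ≤ᵉ (x +ᵉ x′) → ¬ (t ≤ᵉ (y +ᵉ y′))
+ᵉ-interchange-threshold (fin a) (fin b) (fin c) (fin d) t≰a+b t≰c+d =
  +-interchange-threshold a b c d (ℚₚ.≰⇒> t≰a+b) (ℚₚ.≰⇒> t≰c+d)
+ᵉ-interchange-threshold ∞       _       _       _       t≰ _  = ⊥-elim (t≰ tt)
+ᵉ-interchange-threshold (fin _) ∞       _       _       t≰ _  = ⊥-elim (t≰ tt)
+ᵉ-interchange-threshold (fin _) (fin _) ∞       _       _  t≰ = ⊥-elim (t≰ tt)
+ᵉ-interchange-threshold (fin _) (fin _) (fin _) ∞       _  t≰ = ⊥-elim (t≰ tt)

adjacent⇒≢ : (G : Graph n) {x y : Fin n} → Adj G x y → x ≢ y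
adjacent⇒≢ G xy refl = irrefl G xy

record CrossedNonEdges (G : Graph n) (c : ℕ) : Set where
  field
    left right    : Fin c → Fin n
    left≢right    : ∀ q → left q ≢ right q
    nonAdjacent   : ∀ q → ¬ Adj G (left q) (right q)
    leftAdjacent  : ∀ {q q′} → q ≢ q′ → Adj G (left q) (left q′)
    rightAdjacent : ∀ {q q′} → q ≢ q′ → Adj G (right q) (right q′)

crossedNonEdges⇒≤dim : ∀ {G : Graph n} {c} → CrossedNonEdges G c → ThresholdRep G r → c ℕ.≤ r
crossedNonEdges⇒≤dim {n} {r} {G} {c} E (f , t , _ , represents) = injective⇒≤ coordinate-injective
  where
  open CrossedNonEdges E

  Below : Fin c → Fin r → Set
  Below q i = ¬ (t ≤ᵉ (lookup (f (left q)) i +ᵉ lookup (f (right q)) i))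

  above : ∀ {x y} → Adj G x y → ∀ i → t ≤ᵉ (lookup (f x) i +ᵉ lookup (f y) i)
  above xy = ≤ᵉ-⊙⁻ (f _) (f _) (proj₁ (represents _ _ (adjacent⇒≢ G xy)) xy)

  witness : ∀ q → ∃ (Below q)
  witness q = ≰ᵉ-⊙⁻ (f (left q)) (f (right q)) (nonAdjacent q ∘ proj₂ (represents _ _ (left≢right q)))

  coordinate : Fin c → Fin r
  coordinate q = proj₁ (witness q)

  coordinate-injective : Injective _≡_ _≡_ coordinate
  coordinate-injective {q} {q′} same = decidable-stable (q ≟ q′) λ q≢q′ →
    +ᵉ-interchange-threshold _ _ _ _ (proj₂ (witness q)) (subst (Below q′) (≡.sym same) (proj₂ (witness q′)))
      (above (leftAdjacent q≢q′) (coordinate q)) (above (rightAdjacent q≢q′) (coordinate q))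

Unique⇒lookup-injective : {xs : List A} → Unique xs → Injective _≡_ _≡_ (List.lookup xs)
Unique⇒lookup-injective (_ ∷ _)         {zero}  {zero}  _ = refl
Unique⇒lookup-injective (x∉xs ∷ _)      {zero}  {suc j} e = ⊥-elim (All.lookup x∉xs (∈-lookup j) e)
Unique⇒lookup-injective (x∉xs ∷ _)      {suc i} {zero}  e = ⊥-elim (All.lookup x∉xs (∈-lookup i) (≡.sym e))
Unique⇒lookup-injective (_ ∷ xs-unique) {suc i} {suc j} e = cong suc (Unique⇒lookup-injective xs-unique e)

length≡1⇒∈-unique : {xs : List A} → length xs ≡ 1 → ∀ {x y} → x ∈ xs → y ∈ xs → x ≡ y
length≡1⇒∈-unique {xs = _ ∷ []} _ (here refl) (here refl) = refl

length≢1⇒two-distinct : {xs : List A} → Unique xs → length xs ≢ 1 → ∀ {x} → x ∈ xs →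
                        ∃₂ λ a b → a ≢ b × a ∈ xs × b ∈ xs
length≢1⇒two-distinct {xs = _ ∷ []}    _                   ≢1 _ = ⊥-elim (≢1 refl)
length≢1⇒two-distinct {xs = a ∷ b ∷ _} ((a≢b All.∷ _) ∷ _) _  _ = a , b , a≢b , here refl , there (here refl)

length-filter+length-filter-¬ : {P : A → Set} (P? : Decidable P) (xs : List A) →
                                length (filter P? xs) ℕ.+ length (filter (¬? ∘ P?) xs) ≡ length xs
length-filter+length-filter-¬ P? []       = refl
length-filter+length-filter-¬ P? (x ∷ xs) with P? x
... | yes _ = cong ℕ.suc (length-filter+length-filter-¬ P? xs)
... | no  _ = ≡.trans (ℕₚ.+-suc _ _) (cong ℕ.suc (length-filter+length-filter-¬ P? xs))

module _ (p : Fin n → Fin k) where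

  part : Fin k → List (Fin n)
  part i = filter (λ x → p x ≟ i) (allFin n)

  part-unique : ∀ i → Unique (part i)
  part-unique i = filter⁺ (λ x → p x ≟ i) (allFin⁺ n)

  ∈-part⁺ : ∀ {x i} → p x ≡ i → x ∈ part i
  ∈-part⁺ {x} {i} = ∈-filter⁺ (λ x → p x ≟ i) (∈-allFin x)

  ∈-part⁻ : ∀ {x i} → x ∈ part i → p x ≡ i
  ∈-part⁻ {x} {i} = proj₂ ∘ ∈-filter⁻ (λ x → p x ≟ i) {xs = allFin n}

  isSingletonPart? : Decidable (λ i → partSize p i ≡ 1)
  isSingletonPart? i = partSize p i ℕ.≟ 1

  nonSingletonParts : List (Fin k)
  nonSingletonParts = filter (¬? ∘ isSingletonPart?) (allFin k)

  nonSingletonParts-unique : Unique nonSingletonParts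
  nonSingletonParts-unique = filter⁺ (¬? ∘ isSingletonPart?) (allFin⁺ k)

  length-nonSingletonParts : length nonSingletonParts ≡ k ∸ numSingletonParts p
  length-nonSingletonParts = begin
    length nonSingletonParts
      ≡⟨ ℕₚ.m+n∸m≡n (numSingletonParts p) _ ⟨
    numSingletonParts p ℕ.+ length nonSingletonParts ∸ numSingletonParts p
      ≡⟨ cong (_∸ numSingletonParts p) (length-filter+length-filter-¬ isSingletonPart? (allFin k)) ⟩
    length (allFin k) ∸ numSingletonParts p
      ≡⟨ cong (_∸ numSingletonParts p) (length-tabulate (λ i → i)) ⟩
    k ∸ numSingletonParts p
      ∎
    where open ≡-Reasoning

  sharedPart∈nonSingletonParts : ∀ {x y} → x ≢ y → p x ≡ p y → p x ∈ nonSingletonParts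
  sharedPart∈nonSingletonParts {x} {y} x≢y px≡py = ∈-filter⁺ (¬? ∘ isSingletonPart?) (∈-allFin (p x))
    λ size≡1 → x≢y (length≡1⇒∈-unique size≡1 (∈-part⁺ refl) (∈-part⁺ (≡.sym px≡py)))

  record TwoMembers (i : Fin k) : Set where
    field
      first second : Fin n
      first≢second : first ≢ second
      first∈i      : p first ≡ i
      second∈i     : p second ≡ i

  nonSingletonPart⇒twoMembers : ∀ {i} → i ∈ nonSingletonParts → (∃ λ x → p x ≡ i) → TwoMembers i
  nonSingletonPart⇒twoMembers {i} i∈ (x , px≡i) =
    let a , b , a≢b , a∈i , b∈i = length≢1⇒two-distinct (part-unique i) size≢1 (∈-part⁺ px≡i)
    in record { first = a ; second = b ; first≢second = a≢b ; first∈i = ∈-part⁻ a∈i ; second∈i = ∈-part⁻ b∈i }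
    where
    size≢1 : partSize p i ≢ 1
    size≢1 = proj₂ (∈-filter⁻ (¬? ∘ isSingletonPart?) {xs = allFin k} i∈)

indicatorᵉ : Fin k → Fin k → Ext
indicatorᵉ j i with j ≟ i
... | yes _ = fin ℚ.0ℚ
... | no  _ = ∞

indicatorᵉ-self : (j : Fin k) → indicatorᵉ j j ≡ fin ℚ.0ℚ
indicatorᵉ-self j with j ≟ j
... | yes _   = refl
... | no  j≢j = ⊥-elim (j≢j refl)

indicatorᵉ-+ᵉ-≢ : (j : Fin k) {i i′ : Fin k} → i ≢ i′ → indicatorᵉ j i +ᵉ indicatorᵉ j i′ ≡ ∞
indicatorᵉ-+ᵉ-≢ j {i} {i′} i≢i′ with j ≟ i | j ≟ i′
... | yes refl | yes refl = ⊥-elim (i≢i′ refl)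
... | yes _    | no  _    = refl
... | no  _    | _        = refl

module _ {G : Graph n} {p : Fin n → Fin k} (cp : IsCompletePartition G k p) where

  adjacent⇒differentParts : ∀ {x y} → Adj G x y → p x ≢ p y
  adjacent⇒differentParts xy = proj₁ (proj₂ cp _ _ (adjacent⇒≢ G xy)) xy

  differentParts⇒adjacent : ∀ {x y} → p x ≢ p y → Adj G x y
  differentParts⇒adjacent px≢py = proj₂ (proj₂ cp _ _ (px≢py ∘ cong p)) px≢py

  completePartite-thresholdRep : (J : List (Fin k)) → (∀ {x y} → x ≢ y → p x ≡ p y → p x ∈ J) →
                                 ThresholdRep G (length J)
  completePartite-thresholdRep J sharedPart∈J = f , ℚ.1ℚ , ℚₚ.positive⁻¹ ℚ.1ℚ , λ x y x≢y →
    differentParts⇒above ∘ adjacent⇒differentParts ,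
    λ above → differentParts⇒adjacent λ px≡py → sharedPart⇒¬above x≢y px≡py above
    where
    f : Fin n → Vec Ext (length J)
    f x = tabulate λ q → indicatorᵉ (List.lookup J q) (p x)

    coordinateSum : ∀ x y q → lookup (f x) q +ᵉ lookup (f y) q
                              ≡ indicatorᵉ (List.lookup J q) (p x) +ᵉ indicatorᵉ (List.lookup J q) (p y)
    coordinateSum x y q = cong₂ _+ᵉ_ (lookup∘tabulate _ q) (lookup∘tabulate _ q)

    differentParts⇒above : ∀ {x y} → p x ≢ p y → ℚ.1ℚ ≤ᵉ (f x ⊙ f y)
    differentParts⇒above {x} {y} px≢py = ≤ᵉ-⊙⁺ (f x) (f y) λ q →
      subst (ℚ.1ℚ ≤ᵉ_) (≡.sym (≡.trans (coordinateSum x y q) (indicatorᵉ-+ᵉ-≢ _ px≢py))) tt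

    sharedPart⇒¬above : ∀ {x y} → x ≢ y → p x ≡ p y → ¬ (ℚ.1ℚ ≤ᵉ (f x ⊙ f y))
    sharedPart⇒¬above {x} {y} x≢y px≡py above = 1≰0 (subst (ℚ.1ℚ ≤ᵉ_) sum≡0 (≤ᵉ-⊙⁻ (f x) (f y) above q))
      where
      1≰0 : ¬ (ℚ.1ℚ ℚ.≤ ℚ.0ℚ)
      1≰0 = ℚₚ.<-irrefl refl ∘ ℚₚ.<-≤-trans (ℚₚ.positive⁻¹ ℚ.1ℚ)

      px∈J : p x ∈ J
      px∈J = sharedPart∈J x≢y px≡py

      q : Fin (length J)
      q = index px∈J

      sum≡0 : lookup (f x) q +ᵉ lookup (f y) q ≡ fin ℚ.0ℚ
      sum≡0 = begin
        lookup (f x) q +ᵉ lookup (f y) q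
          ≡⟨ coordinateSum x y q ⟩
        indicatorᵉ (List.lookup J q) (p x) +ᵉ indicatorᵉ (List.lookup J q) (p y)
          ≡⟨ cong₂ (λ j i → indicatorᵉ j (p x) +ᵉ indicatorᵉ j i) (lookup-index px∈J) px≡py ⟨
        indicatorᵉ (p x) (p x) +ᵉ indicatorᵉ (p x) (p x)
          ≡⟨ cong₂ _+ᵉ_ (indicatorᵉ-self (p x)) (indicatorᵉ-self (p x)) ⟩
        fin ℚ.0ℚ ∎
        where open ≡-Reasoning

  nonSingletonParts-crossedNonEdges : CrossedNonEdges G (length (nonSingletonParts p))
  nonSingletonParts-crossedNonEdges = record
    { left          = M.first
    ; right         = M.second
    ; left≢right    = M.first≢second
    ; nonAdjacent   = λ q adj → adjacent⇒differentParts adj (≡.trans (M.first∈i q) (≡.sym (M.second∈i q)))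
    ; leftAdjacent  = λ q≢q′ → differentParts⇒adjacent (partsDiffer M.first∈i q≢q′)
    ; rightAdjacent = λ q≢q′ → differentParts⇒adjacent (partsDiffer M.second∈i q≢q′)
    }
    where
    J : List (Fin k)
    J = nonSingletonParts p

    module M q = TwoMembers (nonSingletonPart⇒twoMembers p (∈-lookup q) (proj₁ cp (List.lookup J q)))

    partsDiffer : ∀ {c : Fin (length J) → Fin n} → (∀ q → p (c q) ≡ List.lookup J q) →
                  ∀ {q q′} → q ≢ q′ → p (c q) ≢ p (c q′)
    partsDiffer c∈ {q} {q′} q≢q′ same =
      q≢q′ (Unique⇒lookup-injective (nonSingletonParts-unique p) (≡.trans (≡.sym (c∈ q)) (≡.trans same (c∈ q′))))

mainTheorem18 : ∀ {n} (G : Graph n) (k m : ℕ) (p : Fin n → Fin k) →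
    IsCompletePartition G k p → numSingletonParts p ≡ m → m < k →
    ρT≡ G (k ∸ m)
mainTheorem18 G k m p cp refl _ =
  subst (ThresholdRep G) (length-nonSingletonParts p)
    (completePartite-thresholdRep {G = G} {p = p} cp (nonSingletonParts p) (sharedPart∈nonSingletonParts p)) ,
  λ s rep → subst (ℕ._≤ s) (length-nonSingletonParts p)
    (crossedNonEdges⇒≤dim (nonSingletonParts-crossedNonEdges {G = G} {p = p} cp) rep)
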